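{- Let $s>2$ and $t>3$ be integers and let $F_1$ be the following set of vertices of the wall $W_{s,t}$: $F_1=\{v_{i,j}\mid i\in[s+1], j\in[2]\}\cup\{u_{i,2}\mid i\in[s+1]\}\cup\{v_{i,t},u_{i,t}\mid i\in[s+1]\}\cup\{v_{i,t+1}\mid i\in[s+1]$, if $t$ is odd$\}\cup\{u_{i,t+1}\mid i\in[s+1]$, if $t$ is even$\}$. Then every $5$-cycle in $W_{s,t}$ has all its vertices in $F_1$.
   Context: Wall $W_{s,t}$ (width $s$, height $t$): vertices $v_{i,j}$ ($i\in[s+1]$, $j\in[t]$); $v_{i,t+1}$ ($i\in[s+1]$) if $t$ odd; $u_{i,j}$ ($i\in[s+1]$, $2\le j\le t$); $u_{i,t+1}$ ($i\in[s+1]$) if $t$ even. Edges: $v_{i,1}v_{i+1,1}$ ($i\in[s]$); $v_{i,t+1}v_{i+1,t+1}$ ($i\in[s]$) if $t$ odd; $u_{i,t+1}u_{i+1,t+1}$ ($i\in[s]$) if $t$ even; $v_{i,j}u_{i,j}$ ($i\in[s+1]$, $2\le j\le t$); $u_{i,j}v_{i+1,j}$ ($i\in[s]$, $2\le j\le t$); $v_{i,j}v_{i,j+1}$ ($i\in[s+1]$, odd $j\in[t]$); $u_{i,j}u_{i,j+1}$ ($i\in[s+1]$, even $j\in[t]$). -}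

module Defs where

open import Data.Nat using (ℕ; zero; suc; _+_; _≤_)
open import Data.Nat.Divisibility using (_∣_)
open import Data.Fin using (Fin; zero; suc)
open import Data.Sum using (_⊎_)
open import Data.Product using (_×_)
open import Relation.Binary.PropositionalEquality using (_≡_)
open import Relation.Nullary using (¬_)
open import Function.Definitions using (Injective)

Even : ℕ → Set
Even n = 2 ∣ n

Odd : ℕ → Set
Odd n = ¬ (2 ∣ n)

-- Vertex names of a wall: v i j and u i j (1-based indices, as in the paper).
data V : Set where
  v : ℕ → ℕ → V
  u : ℕ → ℕ → V

_∈[_] : ℕ → ℕ → Set
i ∈[ n ] = 1 ≤ i × i ≤ n

IsVertex : ℕ → ℕ → V → Set
IsVertex s t (v i j) = i ∈[ s + 1 ] × (j ∈[ t ] ⊎ (j ≡ t + 1 × Odd t))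
IsVertex s t (u i j) = i ∈[ s + 1 ] × ((2 ≤ j × j ≤ t) ⊎ (j ≡ t + 1 × Even t))

-- Edges of the wall W_{s,t} (each listed once, in one orientation).
data Edge (s t : ℕ) : V → V → Set where
  bot   : ∀ {i} → i ∈[ s ] → Edge s t (v i 1) (v (suc i) 1)
  topV  : ∀ {i} → Odd t → i ∈[ s ] → Edge s t (v i (t + 1)) (v (suc i) (t + 1))
  topU  : ∀ {i} → Even t → i ∈[ s ] → Edge s t (u i (t + 1)) (u (suc i) (t + 1))
  vu    : ∀ {i j} → i ∈[ s + 1 ] → 2 ≤ j → j ≤ t → Edge s t (v i j) (u i j)
  uv    : ∀ {i j} → i ∈[ s ] → 2 ≤ j → j ≤ t → Edge s t (u i j) (v (suc i) j)
  vv    : ∀ {i j} → i ∈[ s + 1 ] → j ∈[ t ] → Odd j → Edge s t (v i j) (v i (suc j))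
  uu    : ∀ {i j} → i ∈[ s + 1 ] → j ∈[ t ] → Even j → Edge s t (u i j) (u i (suc j))

Adj : ℕ → ℕ → V → V → Set
Adj s t x y = Edge s t x y ⊎ Edge s t y x

next5 : Fin 5 → Fin 5
next5 zero = suc zero
next5 (suc zero) = suc (suc zero)
next5 (suc (suc zero)) = suc (suc (suc zero))
next5 (suc (suc (suc zero))) = suc (suc (suc (suc zero)))
next5 (suc (suc (suc (suc zero)))) = zero

Is5Cycle : ℕ → ℕ → (Fin 5 → V) → Set
Is5Cycle s t c = Injective _≡_ _≡_ c × (∀ k → IsVertex s t (c k)) × (∀ k → Adj s t (c k) (c (next5 k)))

InF₁ : ℕ → ℕ → V → Set
InF₁ s t (v i j) = i ∈[ s + 1 ] × (j ∈[ 2 ] ⊎ j ≡ t ⊎ (j ≡ t + 1 × Odd t))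
InF₁ s t (u i j) = i ∈[ s + 1 ] × (j ≡ 2 ⊎ j ≡ t ⊎ (j ≡ t + 1 × Even t))

module Submission where

-- Remove the bottom row edges v_{i,1}v_{i+1,1} and the top row edges: what is left of the wall
-- is bipartite, coloured by the parity of the row index j, shifted by one on the u-vertices.
-- An odd cycle must therefore use a row edge, so it passes through the bottom or the top row.
-- Since any two vertices of a 5-cycle are at distance at most 2 in it, every vertex of the
-- cycle is within distance 2 of the bottom row or of the top row, and those vertices are
-- exactly the ones in F₁.

open import Defs
open import Data.Nat using (ℕ; zero; suc; _+_; _∸_; _≤_; _<_; s≤s; z≤n; _≤?_)
open import Data.Nat.Properties using (module ≤-Reasoning; ≤-trans; ≤-refl; ≤-antisym; n≤1+n; +-comm; +-∸-assoc; m∸n≡0⇒m≤n; m∸n+n≡m)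
open import Data.Nat.Divisibility using (_∣_; _∣?_; ∣1⇒≡1; ∣m+n∣m⇒∣n; divides)
open import Data.Fin using (Fin; zero; suc; #_) renaming (_≟_ to _≟ᶠ_)
open import Data.Fin.Properties using (all?)
open import Data.Bool using (Bool; true; false; not; if_then_else_)
open import Data.Bool.Properties using (not-involutive; not-¬)
open import Data.Product using (_×_; _,_; proj₁; proj₂)
open import Data.Sum using (_⊎_; inj₁; inj₂)
import Data.Sum as Sum
open import Function using (id; _∘_)
open import Relation.Nullary using (¬_; Dec; yes; no; contradiction)
open import Relation.Nullary.Decidable using (True; toWitness; from-yes; _⊎-dec_)
open import Relation.Binary.PropositionalEquality using (_≡_; _≢_; refl; sym; trans; cong; subst; module ≡-Reasoning)

even⇒odd-suc : ∀ n → Even n → Odd (suc n)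
even⇒odd-suc n 2∣n 2∣1+n with ∣1⇒≡1 (∣m+n∣m⇒∣n (subst (2 ∣_) (+-comm 1 n) 2∣1+n) 2∣n)
... | ()

odd⇒even-suc : ∀ n → Odd n → Even (suc n)
odd⇒even-suc zero    odd = contradiction (divides 0 refl) odd
odd⇒even-suc (suc n) odd with 2 ∣? n
... | yes (divides q n≡q*2) = divides (suc q) (cong (λ m → suc (suc m)) n≡q*2)
... | no  ¬2∣n              = contradiction (odd⇒even-suc n ¬2∣n) odd

Parity : Bool → ℕ → Set
Parity true  n = Odd n
Parity false n = Even n

Close : ℕ → ℕ → Set
Close a c = a ≤ suc c × c ≤ suc a

close : ∀ a c → {True (a ≤? suc c)} → {True (c ≤? suc a)} → Close a c
close a c {a≤1+c} {c≤1+a} = toWitness a≤1+c , toWitness c≤1+a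

close-refl : ∀ a → Close a a
close-refl a = n≤1+n a , n≤1+n a

close-sym : ∀ {a c} → Close a c → Close c a
close-sym (a≤1+c , c≤1+a) = c≤1+a , a≤1+c

Lipschitz : ℕ → ℕ → (V → ℕ) → Set
Lipschitz s t f = ∀ {x y} → Edge s t x y → Close (f x) (f y)

lipschitz-adj : ∀ {s t f x y} → Lipschitz s t f → Adj s t x y → Close (f x) (f y)
lipschitz-adj lip (inj₁ e) = lip e
lipschitz-adj lip (inj₂ e) = close-sym (lip e)

-- Distances to the bottom and top rows, capped at 3.

bottomDistanceV : ℕ → ℕ
bottomDistanceV 1 = 0
bottomDistanceV 2 = 1
bottomDistanceV _ = 3

bottomDistanceU : ℕ → ℕ
bottomDistanceU 2 = 2
bottomDistanceU _ = 3

bottomDistance : V → ℕ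
bottomDistance (v _ j) = bottomDistanceV j
bottomDistance (u _ j) = bottomDistanceU j

bottomDistance-lipschitz : ∀ {s t} → Lipschitz s t bottomDistance
bottomDistance-lipschitz (bot _)    = close-refl _
bottomDistance-lipschitz (topV _ _) = close-refl _
bottomDistance-lipschitz (topU _ _) = close-refl _
bottomDistance-lipschitz (vu {j = 0} _ () _)
bottomDistance-lipschitz (vu {j = 1} _ (s≤s ()) _)
bottomDistance-lipschitz (vu {j = 2} _ _ _) = close _ _
bottomDistance-lipschitz (vu {j = suc (suc (suc _))} _ _ _) = close _ _
bottomDistance-lipschitz (uv {j = 0} _ () _)
bottomDistance-lipschitz (uv {j = 1} _ (s≤s ()) _)
bottomDistance-lipschitz (uv {j = 2} _ _ _) = close _ _
bottomDistance-lipschitz (uv {j = suc (suc (suc _))} _ _ _) = close _ _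
bottomDistance-lipschitz (vv {j = 0} _ (() , _) _)
bottomDistance-lipschitz (vv {j = 1} _ _ _) = close _ _
bottomDistance-lipschitz (vv {j = 2} _ _ odd) = contradiction (divides 1 refl) odd
bottomDistance-lipschitz (vv {j = suc (suc (suc _))} _ _ _) = close _ _
bottomDistance-lipschitz (uu {j = 0} _ _ _) = close _ _
bottomDistance-lipschitz (uu {j = 1} _ _ _) = close _ _
bottomDistance-lipschitz (uu {j = 2} _ _ _) = close _ _
bottomDistance-lipschitz (uu {j = suc (suc (suc _))} _ _ _) = close _ _

-- Measured through the depth t + 1 ∸ j below the top row. The flag b is true when t is odd,
-- that is, when the top row consists of v-vertices and v_{i,t} rather than u_{i,t} is adjacent to it.

topDistanceV : Bool → ℕ → ℕ
topDistanceV b zero          = 0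
topDistanceV b (suc zero)    = if b then 1 else 2
topDistanceV b (suc (suc _)) = 3

topDistanceU : Bool → ℕ → ℕ
topDistanceU b zero          = 0
topDistanceU b (suc zero)    = if b then 2 else 1
topDistanceU b (suc (suc _)) = 3

topDistance : Bool → ℕ → V → ℕ
topDistance b t (v _ j) = topDistanceV b (suc t ∸ j)
topDistance b t (u _ j) = topDistanceU b (suc t ∸ j)

topDistanceV-U-close : ∀ b d → Close (topDistanceV b d) (topDistanceU b d)
topDistanceV-U-close b     zero          = close _ _
topDistanceV-U-close true  (suc zero)    = close _ _
topDistanceV-U-close false (suc zero)    = close _ _
topDistanceV-U-close b     (suc (suc _)) = close _ _

∸≡0⇒≡ : ∀ {t j} → j ≤ t → t ∸ j ≡ 0 → j ≡ t
∸≡0⇒≡ j≤t t∸j≡0 = ≤-antisym j≤t (m∸n≡0⇒m≤n t∸j≡0)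

∸≡1⇒suc≡ : ∀ {t j} → j ≤ t → t ∸ j ≡ 1 → suc j ≡ t
∸≡1⇒suc≡ {t} {j} j≤t t∸j≡1 = trans (cong (_+ j) (sym t∸j≡1)) (m∸n+n≡m j≤t)

topDistanceV-step : ∀ b t j → Parity b t → Odd j → j ≤ t →
                    Close (topDistanceV b (suc t ∸ j)) (topDistanceV b (t ∸ j))
topDistanceV-step b t j par odd j≤t rewrite +-∸-assoc 1 j≤t with t ∸ j in t∸j
topDistanceV-step true  t j par odd j≤t | zero = close _ _
topDistanceV-step false t j par odd j≤t | zero =
  contradiction (subst Even (sym (∸≡0⇒≡ j≤t t∸j)) par) odd
topDistanceV-step true  t j par odd j≤t | suc zero =
  contradiction (subst Even (∸≡1⇒suc≡ j≤t t∸j) (odd⇒even-suc j odd)) par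
topDistanceV-step false t j par odd j≤t | suc zero    = close _ _
topDistanceV-step b     t j par odd j≤t | suc (suc _) = close _ _

topDistanceU-step : ∀ b t j → Parity b t → Even j → j ≤ t →
                    Close (topDistanceU b (suc t ∸ j)) (topDistanceU b (t ∸ j))
topDistanceU-step b t j par even j≤t rewrite +-∸-assoc 1 j≤t with t ∸ j in t∸j
topDistanceU-step true  t j par even j≤t | zero =
  contradiction (subst Even (∸≡0⇒≡ j≤t t∸j) even) par
topDistanceU-step false t j par even j≤t | zero     = close _ _
topDistanceU-step true  t j par even j≤t | suc zero = close _ _
topDistanceU-step false t j par even j≤t | suc zero =
  contradiction (subst Even (sym (∸≡1⇒suc≡ j≤t t∸j)) par) (even⇒odd-suc j even)
topDistanceU-step b     t j par even j≤t | suc (suc _) = close _ _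

topDistance-lipschitz : ∀ {s t} b → Parity b t → Lipschitz s t (topDistance b t)
topDistance-lipschitz b par (bot _)    = close-refl _
topDistance-lipschitz b par (topV _ _) = close-refl _
topDistance-lipschitz b par (topU _ _) = close-refl _
topDistance-lipschitz {t = t} b par (vu {j = j} _ _ _) = topDistanceV-U-close b (suc t ∸ j)
topDistance-lipschitz {t = t} b par (uv {j = j} _ _ _) = close-sym (topDistanceV-U-close b (suc t ∸ j))
topDistance-lipschitz {t = t} b par (vv {j = j} _ (_ , j≤t) odd)  = topDistanceV-step b t j par odd j≤t
topDistance-lipschitz {t = t} b par (uu {j = j} _ (_ , j≤t) even) = topDistanceU-step b t j par even j≤t

isOdd : ℕ → Bool
isOdd zero    = false
isOdd (suc n) = not (isOdd n)

colour : V → Bool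
colour (v _ j) = isOdd j
colour (u _ j) = not (isOdd j)

top-row-depth : ∀ t → suc t ∸ (t + 1) ≡ 0
top-row-depth zero    = refl
top-row-depth (suc t) = top-row-depth t

OnRow : Bool → ℕ → V → Set
OnRow b t x = bottomDistance x ≡ 0 ⊎ topDistance b t x ≡ 0

row-edge⊎flips-colour : ∀ b {s t x y} → Edge s t x y → OnRow b t x ⊎ colour y ≡ not (colour x)
row-edge⊎flips-colour b (bot _)                = inj₁ (inj₁ refl)
row-edge⊎flips-colour b {t = t} (topV _ _)     = inj₁ (inj₂ (cong (topDistanceV b) (top-row-depth t)))
row-edge⊎flips-colour b {t = t} (topU _ _)     = inj₁ (inj₂ (cong (topDistanceU b) (top-row-depth t)))
row-edge⊎flips-colour b (vu _ _ _)             = inj₂ refl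
row-edge⊎flips-colour b (uv {j = j} _ _ _)     = inj₂ (sym (not-involutive (isOdd j)))
row-edge⊎flips-colour b (vv _ _ _)             = inj₂ refl
row-edge⊎flips-colour b (uu _ _ _)             = inj₂ refl

flip-sym : ∀ {x y} → y ≡ not x → x ≡ not y
flip-sym {x} y≡¬x = sym (trans (cong not y≡¬x) (not-involutive x))

WithinTwoSteps : Fin 5 → Fin 5 → Set
WithinTwoSteps k a = a ≡ k ⊎ a ≡ next5 k ⊎ a ≡ next5 (next5 k) ⊎ k ≡ next5 a ⊎ k ≡ next5 (next5 a)

withinTwoSteps : ∀ k a → WithinTwoSteps k a
withinTwoSteps = from-yes (all? λ k → all? λ a → within? k a)
  where
  within? : ∀ k a → Dec (WithinTwoSteps k a)
  within? k a = (a ≟ᶠ k) ⊎-dec (a ≟ᶠ next5 k) ⊎-dec (a ≟ᶠ next5 (next5 k))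
                ⊎-dec (k ≟ᶠ next5 a) ⊎-dec (k ≟ᶠ next5 (next5 a))

cycle-spread : (g : Fin 5 → ℕ) → (∀ k → Close (g k) (g (next5 k))) → ∀ k a → g k ≤ 2 + g a
cycle-spread g close-next k a with withinTwoSteps k a
... | inj₁ refl = ≤-trans (n≤1+n _) (n≤1+n _)
... | inj₂ (inj₁ refl) = ≤-trans (proj₁ (close-next k)) (n≤1+n _)
... | inj₂ (inj₂ (inj₁ refl)) = ≤-trans (proj₁ (close-next k)) (s≤s (proj₁ (close-next (next5 k))))
... | inj₂ (inj₂ (inj₂ (inj₁ refl))) = ≤-trans (proj₂ (close-next a)) (n≤1+n _)
... | inj₂ (inj₂ (inj₂ (inj₂ refl))) = ≤-trans (proj₂ (close-next (next5 a))) (s≤s (proj₂ (close-next a)))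

CycleIn : ℕ → ℕ → (Fin 5 → V) → Set
CycleIn s t c = ∀ k → Adj s t (c k) (c (next5 k))

cycle-avoids-zeros : ∀ {s t f} → Lipschitz s t f → (c : Fin 5 → V) → CycleIn s t c →
                     ∀ k → 3 ≤ f (c k) → ∀ a → f (c a) ≢ 0
cycle-avoids-zeros {f = f} lip c adj k 3≤fck a fca≡0 = 3≰2 (begin
  3             ≤⟨ 3≤fck ⟩
  f (c k)       ≤⟨ cycle-spread (f ∘ c) (lipschitz-adj lip ∘ adj) k a ⟩
  2 + f (c a)   ≡⟨ cong (2 +_) fca≡0 ⟩
  2             ∎)
  where
  open ≤-Reasoning
  3≰2 : ¬ (3 ≤ 2)
  3≰2 (s≤s (s≤s ()))

no-alternating-5 : (f : Fin 5 → Bool) → ¬ (∀ k → f (next5 k) ≡ not (f k))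
no-alternating-5 f alt = not-¬ refl (begin
  f (# 0)                  ≡⟨ alt (# 4) ⟩
  not (f (# 4))            ≡⟨ cong not (alt (# 3)) ⟩
  not (not (f (# 3)))      ≡⟨ not-involutive (f (# 3)) ⟩
  f (# 3)                  ≡⟨ alt (# 2) ⟩
  not (f (# 2))            ≡⟨ cong not (alt (# 1)) ⟩
  not (not (f (# 1)))      ≡⟨ not-involutive (f (# 1)) ⟩
  f (# 1)                  ≡⟨ alt (# 0) ⟩
  not (f (# 0))            ∎)
  where open ≡-Reasoning

FarFromRows : Bool → ℕ → V → Set
FarFromRows b t x = 3 ≤ bottomDistance x × 3 ≤ topDistance b t x

top-row⊎deep : ∀ {t j} → j ≤ t → j ≡ t ⊎ 2 ≤ suc t ∸ j
top-row⊎deep {zero}          z≤n       = inj₁ refl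
top-row⊎deep {suc t} {zero}  z≤n       = inj₂ (s≤s (s≤s z≤n))
top-row⊎deep                 (s≤s j≤t) = Sum.map (cong suc) id (top-row⊎deep j≤t)

deep⇒far-topDistanceV : ∀ b {d} → 2 ≤ d → 3 ≤ topDistanceV b d
deep⇒far-topDistanceV b (s≤s (s≤s _)) = ≤-refl

deep⇒far-topDistanceU : ∀ b {d} → 2 ≤ d → 3 ≤ topDistanceU b d
deep⇒far-topDistanceU b (s≤s (s≤s _)) = ≤-refl

inF₁⊎farFromRows : ∀ b {s t} x → IsVertex s t x → InF₁ s t x ⊎ FarFromRows b t x
inF₁⊎farFromRows b (v i j) (i∈ , inj₂ top)    = inj₁ (i∈ , inj₂ (inj₂ top))
inF₁⊎farFromRows b (v i 1) (i∈ , inj₁ _)      = inj₁ (i∈ , inj₁ (≤-refl , s≤s z≤n))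
inF₁⊎farFromRows b (v i 2) (i∈ , inj₁ _)      = inj₁ (i∈ , inj₁ (s≤s z≤n , ≤-refl))
inF₁⊎farFromRows b (v i (suc (suc (suc j)))) (i∈ , inj₁ (_ , j≤t)) with top-row⊎deep j≤t
... | inj₁ j≡t = inj₁ (i∈ , inj₂ (inj₁ j≡t))
... | inj₂ deep = inj₂ (≤-refl , deep⇒far-topDistanceV b deep)
inF₁⊎farFromRows b (u i j) (i∈ , inj₂ top)    = inj₁ (i∈ , inj₂ (inj₂ top))
inF₁⊎farFromRows b (u i 2) (i∈ , inj₁ _)      = inj₁ (i∈ , inj₁ refl)
inF₁⊎farFromRows b (u i (suc (suc (suc j)))) (i∈ , inj₁ (_ , j≤t)) with top-row⊎deep j≤t
... | inj₁ j≡t = inj₁ (i∈ , inj₂ (inj₁ j≡t))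
... | inj₂ deep = inj₂ (≤-refl , deep⇒far-topDistanceU b deep)
inF₁⊎farFromRows b (v i 0) (_ , inj₁ (() , _))
inF₁⊎farFromRows b (u i 0) (_ , inj₁ (() , _))
inF₁⊎farFromRows b (u i 1) (_ , inj₁ (s≤s () , _))

no-5-cycle-far-from-rows : ∀ b {s t} → Parity b t → (c : Fin 5 → V) → CycleIn s t c →
                           ∀ k → ¬ FarFromRows b t (c k)
no-5-cycle-far-from-rows b {s} {t} par c adj k (3≤bottom , 3≤top) = no-alternating-5 (colour ∘ c) alternates
  where
  off-rows : ∀ a → ¬ OnRow b t (c a)
  off-rows a = Sum.[ cycle-avoids-zeros bottomDistance-lipschitz c adj k 3≤bottom a
                   , cycle-avoids-zeros (topDistance-lipschitz b par) c adj k 3≤top a ]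

  flips-along : ∀ {x y} → ¬ OnRow b t x → Edge s t x y → colour y ≡ not (colour x)
  flips-along off e = Sum.[ (λ on → contradiction on off) , id ] (row-edge⊎flips-colour b e)

  alternates : ∀ a → colour (c (next5 a)) ≡ not (colour (c a))
  alternates a with adj a
  ... | inj₁ e = flips-along (off-rows a) e
  ... | inj₂ e = flip-sym (flips-along (off-rows (next5 a)) e)

five-cycle⊆F₁ : ∀ b {s t} → Parity b t → (c : Fin 5 → V) → Is5Cycle s t c → ∀ k → InF₁ s t (c k)
five-cycle⊆F₁ b par c (_ , vertex , adj) k with inF₁⊎farFromRows b (c k) (vertex k)
... | inj₁ inF₁ = inF₁
... | inj₂ far = contradiction far (no-5-cycle-far-from-rows b par c adj k)

lemma5p13 : (s t : ℕ) → 2 < s → 3 < t → (c : Fin 5 → V) → Is5Cycle s t c → ∀ k → InF₁ s t (c k)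
lemma5p13 s t _ _ c cycle with 2 ∣? t
... | yes even = five-cycle⊆F₁ false even c cycle
... | no  odd  = five-cycle⊆F₁ true  odd  c cycle
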